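{- For every integer $n\geq 4$, the windmill graph $K_n^{(2)}$ is total prime.
   Context: All graphs are finite and simple. For a graph $G$ with vertex set $V$ and edge set $E$, a total prime labeling is a bijection $\ell: V\cup E\to\{1,2,\ldots,|V|+|E|\}$ such that (i) for every pair of adjacent vertices $u,v$, $\gcd(\ell(u),\ell(v))=1$, and (ii) for every vertex $v$ of degree at least 2, the greatest common divisor of the labels $\ell(uv)$ over all edges $uv$ incident to $v$ equals 1. A graph is total prime if it admits a total prime labeling. The windmill graph $K_n^{(m)}$ consists of $m$ copies of the complete graph $K_n$ that share exactly one common vertex and are otherwise vertex-disjoint. -}

module Defs where

open import Data.Nat using (ℕ; zero; suc; _≤_; _∸_; pred; _*_)
open import Data.Nat.DivMod using (_/_)
open import Data.Nat.GCD using (gcd)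
open import Data.Nat.Coprimality using (Coprime)
open import Data.Fin using (Fin; toℕ; _<?_)
open import Data.Fin.Properties using (_≟_)
open import Data.List using (List; filter; cartesianProduct; allFin; length; lookup; map; foldr)
open import Data.Product using (_×_; _,_; proj₁; proj₂)
open import Data.Sum using (_⊎_; inj₁; inj₂)
open import Relation.Nullary using (¬_; Dec)
open import Relation.Nullary.Decidable using (_×-dec_; _⊎-dec_; ¬?)
open import Relation.Binary using (Decidable)
open import Relation.Binary.PropositionalEquality using (_≡_)
import Data.Nat as ℕ
open import Function.Bundles using (_⤖_; module Bijection)

record Graph : Set₁ where
  field
    order  : ℕ
    Adj    : Fin order → Fin order → Set
    adj?   : Decidable Adj
    sym    : ∀ {u v} → Adj u v → Adj v u
    irrefl : ∀ {v} → ¬ Adj v v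

module _ (G : Graph) where
  open Graph G

  edgeList : List (Fin order × Fin order)
  edgeList = filter (λ p → (proj₁ p <? proj₂ p) ×-dec adj? (proj₁ p) (proj₂ p))
                    (cartesianProduct (allFin order) (allFin order))

  size : ℕ
  size = length edgeList

  Edge : Set
  Edge = Fin size

  endpoints : Edge → Fin order × Fin order
  endpoints e = lookup edgeList e

  incident : Fin order → List Edge
  incident v = filter (λ e → (v ≟ proj₁ (endpoints e)) ⊎-dec (v ≟ proj₂ (endpoints e)))
                      (allFin size)

  degree : Fin order → ℕ
  degree v = length (incident v)

-- gcd of a list of naturals (gcd of the empty list is 0)
gcdList : List ℕ → ℕ
gcdList = foldr gcd 0

-- A total prime labeling: a bijection from V ∪ E onto {1, …, |V|+|E|},
-- encoded as a bijection onto Fin (|V|+|E|) shifted by one.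
record TotalPrimeLabeling (G : Graph) : Set where
  open Graph G
  field
    lab : (Fin order ⊎ Edge G) ⤖ Fin (order ℕ.+ size G)
  ℓ : Fin order ⊎ Edge G → ℕ
  ℓ x = suc (toℕ (Bijection.to lab x))
  field
    vertexCond : ∀ u v → Adj u v → Coprime (ℓ (inj₁ u)) (ℓ (inj₁ v))
    edgeCond   : ∀ v → 2 ≤ degree G v → gcdList (map (λ e → ℓ (inj₂ e)) (incident G v)) ≡ 1

TotalPrime : Graph → Set
TotalPrime G = TotalPrimeLabeling G

-- Windmill graph K_n^(m): vertex 0 is the common centre; vertex i ≥ 1 belongs to
-- copy number (i ∸ 1) / (n ∸ 1).
block : ℕ → ℕ → ℕ
block zero    a = 0
block (suc k) a = a / suc k

WAdj : (n m : ℕ) → Fin (suc (m * pred n)) → Fin (suc (m * pred n)) → Set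
WAdj n m u v = ¬ (u ≡ v) × ((toℕ u ≡ 0 ⊎ toℕ v ≡ 0) ⊎ block (pred n) (toℕ u ∸ 1) ≡ block (pred n) (toℕ v ∸ 1))

windmill : (n m : ℕ) → Graph
windmill n m = record
  { order  = suc (m * pred n)
  ; Adj    = WAdj n m
  ; adj?   = λ u v → ¬? (u ≟ v) ×-dec (((toℕ u ℕ.≟ 0) ⊎-dec (toℕ v ℕ.≟ 0))
                        ⊎-dec (block (pred n) (toℕ u ∸ 1) ℕ.≟ block (pred n) (toℕ v ∸ 1)))
  ; sym    = λ { (ne , inj₁ (inj₁ p)) → (λ e → ne (Relation.Binary.PropositionalEquality.sym e)) , inj₁ (inj₂ p)
               ; (ne , inj₁ (inj₂ p)) → (λ e → ne (Relation.Binary.PropositionalEquality.sym e)) , inj₁ (inj₁ p)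
               ; (ne , inj₂ p) → (λ e → ne (Relation.Binary.PropositionalEquality.sym e)) , inj₂ (Relation.Binary.PropositionalEquality.sym p) }
  ; irrefl = λ { (ne , _) → ne Relation.Binary.PropositionalEquality.refl }
  }

-- Write n = k + 1: the windmill has the centre 0, the copies {0, 1, …, k} and {0, k + 1, …, 2k} of K_n,
-- and k(k + 1) edges.  Label the centre 1 and the other 2k vertices by distinct primes below k(k + 1),
-- so that all vertex labels are pairwise coprime.  The closed walk 0, 1, …, k, 0, k + 1, …, 2k, 0 uses
-- 2k + 2 distinct edges and passes through every vertex between two consecutive ones; giving these
-- edges the 2k + 2 largest labels in walk order puts two consecutive labels at every vertex, so every
-- edge gcd is 1, and the other edges take the remaining labels in any order.  Enough primes exist for
-- k ≥ 48 by Chebyshev's bound 2^m ≤ C(2m, m) ≤ (2m)^π(2m), which holds because every prime power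
-- dividing C(2m, m) is at most 2m; for 4 ≤ k < 48 the first 94 primes suffice, and for k = 3 the
-- labels 2, 3, 11 and 5, 6, 7 serve instead.

module Submission where

open import Defs
open import Data.Nat using (ℕ; _≤_)
open import Data.Nat as ℕ
  using (zero; suc; pred; _+_; _*_; _^_; _∸_; _<_; s≤s; z≤n; _≤?_; _<?_; NonZero; >-nonZero; _!)
open import Data.Nat.Properties
open import Data.Nat.DivMod
  using (_/_; _%_; m≡m%n+[m/n]*n; m%n<n; m/n*n≤m; m/n<m; m/n≤m; m/n/o≡m/[n*o]; /-congʳ; m*n/n≡m; /-monoˡ-≤
        ; m<n⇒m/n≡0; m/n≡1+[m∸n]/n)
open import Data.Nat.Divisibility
  using (_∣_; divides; _∣?_; ∣-trans; ∣1⇒≡1; ∣m+n∣m⇒∣n; ∣⇒≤; n∣m*n; m∣m*n; 1∣_; *-monoʳ-∣; *-cancelˡ-∣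
        ; m≤n⇒m!∣n!)
open import Data.Nat.GCD using (gcd[m,n]∣m; gcd[m,n]∣n)
open import Data.Nat.Coprimality as Coprime using (Coprime; coprime?; prime⇒coprime; 1-coprimeTo)
open import Data.Nat.Combinatorics using (k![n∸k]!∣n!)
open import Data.Nat.Induction using (<-wellFounded)
open import Data.Nat.ListAction using (product)
open import Data.Nat.Primality using (Prime; prime?; euclidsLemma; prime⇒nonZero; prime⇒nonTrivial)
open import Data.Nat.Primality.Factorisation using (factorise; PrimeFactorisation)
open import Data.Nat.Tactic.RingSolver using (solve-∀)
open import Algebra.Properties.CommutativeSemigroup *-commutativeSemigroup using (x∙yz≈y∙xz)
open import Data.Fin as Fin using (Fin; zero; suc; toℕ; fromℕ<; inject≤; punchIn; punchOut; combine; remQuot)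
open import Data.Fin.Patterns using (0F; 1F)
open import Data.Fin.Properties as Finₚ
  using (toℕ-injective; toℕ-fromℕ<; toℕ<n; punchOut-injective; punchIn-punchOut; injective⇒≤; +↔⊎
        ; remQuot-combine; combine-remQuot; toℕ-combine)
open import Data.Fin.Permutation using (Permutation′; _⟨$⟩ʳ_; _⟨$⟩ˡ_; _∘ₚ_; flip; insert; insert-punchIn; inverseˡ)
import Data.Fin.Permutation as Perm
open import Data.List using (List; []; _∷_; length; lookup; take; map; filter; downFrom)
open import Data.List.Membership.Propositional using (_∈_)
open import Data.List.Membership.Propositional.Properties
  using (∈-filter⁺; ∈-cartesianProduct⁺; ∈-map⁺; ∈-allFin; ∈-lookup)
open import Data.List.Relation.Unary.Any using (here; there; index)
open import Data.List.Relation.Unary.Any.Properties using (lookup-index)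
open import Data.List.Relation.Unary.All as All using (All; []; _∷_; all?)
import Data.List.Relation.Unary.All.Properties as Allₚ
open import Data.List.Relation.Unary.AllPairs using (_∷_)
open import Data.List.Relation.Unary.Unique.Propositional using (Unique)
import Data.List.Relation.Unary.Unique.Propositional.Properties as Uniqueₚ
open import Data.List.Relation.Unary.Unique.DecPropositional _≟_ using (unique?)
import Data.Vec as Vec
open import Data.Product as Prod using (Σ-syntax; ∃; ∃₂; _×_; _,_; proj₁; proj₂; uncurry)
open import Data.Sum as Sum using (_⊎_; inj₁; inj₂; [_,_]′)
open import Data.Sum.Properties using (inj₁-injective; inj₂-injective)
open import Function using (_∘_; _↔_; Inverse)
open import Function.Definitions using (Injective)
open import Function.Construct.Composition using (_↔-∘_)
open import Function.Construct.Symmetry using (↔-sym)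
open import Function.Properties.Inverse using (↔⇒⤖)
open import Induction.WellFounded using (Acc; acc)
open import Relation.Binary.Definitions using (tri<; tri≈; tri>)
open import Relation.Nullary using (¬_; Dec; yes; no)
open import Relation.Nullary.Decidable using (toWitness; _→-dec_; _×-dec_; _⊎-dec_)
open import Relation.Nullary.Negation using (contradiction)
open import Relation.Binary.PropositionalEquality

-- Extending injections to bijections

extendToPermutation : ∀ {a n} (φ : Fin a → Fin n) → Injective _≡_ _≡_ φ → (a≤n : a ≤ n) →
                      Σ[ π ∈ Permutation′ n ] ∀ i → π ⟨$⟩ʳ inject≤ i a≤n ≡ φ i
extendToPermutation {zero}          φ φ-inj _         = Perm.id , λ ()
extendToPermutation {suc a} {suc n} φ φ-inj (s≤s a≤n) = insert zero (φ zero) π , extends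
  where
  φ₀≢ : ∀ i → φ zero ≢ φ (suc i)
  φ₀≢ i eq = contradiction (φ-inj eq) λ ()

  φ′ : Fin a → Fin n
  φ′ i = punchOut (φ₀≢ i)

  φ′-inj : Injective _≡_ _≡_ φ′
  φ′-inj eq = Finₚ.suc-injective (φ-inj (punchOut-injective (φ₀≢ _) (φ₀≢ _) eq))

  π : Permutation′ n
  π = proj₁ (extendToPermutation φ′ φ′-inj a≤n)

  π-extends : ∀ i → π ⟨$⟩ʳ inject≤ i a≤n ≡ φ′ i
  π-extends = proj₂ (extendToPermutation φ′ φ′-inj a≤n)

  extends : ∀ i → insert zero (φ zero) π ⟨$⟩ʳ inject≤ i (s≤s a≤n) ≡ φ i
  extends zero    = refl
  extends (suc i) = begin
    insert zero (φ zero) π ⟨$⟩ʳ punchIn zero (inject≤ i a≤n) ≡⟨ insert-punchIn zero (φ zero) π _ ⟩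
    punchIn (φ zero) (π ⟨$⟩ʳ inject≤ i a≤n)                   ≡⟨ cong (punchIn (φ zero)) (π-extends i) ⟩
    punchIn (φ zero) (φ′ i)                                    ≡⟨ punchIn-punchOut (φ₀≢ i) ⟩
    φ (suc i)                                                  ∎
    where open ≡-Reasoning

extendToBijection : ∀ {D A : Set} {a n} → D ↔ Fin a → A ↔ Fin n →
                    (ι : D → A) → Injective _≡_ _≡_ ι → (ψ : D → Fin n) → Injective _≡_ _≡_ ψ →
                    Σ[ f ∈ A ↔ Fin n ] ∀ d → Inverse.to f (ι d) ≡ ψ d
extendToBijection {a = a} {n} eD eA ι ι-inj ψ ψ-inj = (flip σ ∘ₚ τ) ↔-∘ eA , extends
  where
  module eD = Inverse eD
  module eA = Inverse eA

  fromD-inj : Injective _≡_ _≡_ eD.from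
  fromD-inj {x} {y} eq = trans (sym (eD.strictlyInverseˡ x)) (trans (cong eD.to eq) (eD.strictlyInverseˡ y))

  ι′ : Fin a → Fin n
  ι′ = eA.to ∘ ι ∘ eD.from

  ι′-inj : Injective _≡_ _≡_ ι′
  ι′-inj eq = fromD-inj (ι-inj (trans (sym (eA.strictlyInverseʳ _)) (trans (cong eA.from eq) (eA.strictlyInverseʳ _))))

  a≤n : a ≤ n
  a≤n = injective⇒≤ ι′-inj

  σ τ : Permutation′ n
  σ = proj₁ (extendToPermutation ι′ ι′-inj a≤n)
  τ = proj₁ (extendToPermutation (ψ ∘ eD.from) (fromD-inj ∘ ψ-inj) a≤n)

  σ-extends : ∀ i → σ ⟨$⟩ʳ inject≤ i a≤n ≡ ι′ i
  σ-extends = proj₂ (extendToPermutation ι′ ι′-inj a≤n)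

  τ-extends : ∀ i → τ ⟨$⟩ʳ inject≤ i a≤n ≡ ψ (eD.from i)
  τ-extends = proj₂ (extendToPermutation (ψ ∘ eD.from) (fromD-inj ∘ ψ-inj) a≤n)

  extends : ∀ d → τ ⟨$⟩ʳ (σ ⟨$⟩ˡ eA.to (ι d)) ≡ ψ d
  extends d = begin
    τ ⟨$⟩ʳ (σ ⟨$⟩ˡ eA.to (ι d))                   ≡⟨ cong (λ x → τ ⟨$⟩ʳ (σ ⟨$⟩ˡ eA.to (ι x)))
                                                          (eD.strictlyInverseʳ d) ⟨
    τ ⟨$⟩ʳ (σ ⟨$⟩ˡ ι′ (eD.to d))                   ≡⟨ cong (λ x → τ ⟨$⟩ʳ (σ ⟨$⟩ˡ x)) (σ-extends (eD.to d)) ⟨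
    τ ⟨$⟩ʳ (σ ⟨$⟩ˡ (σ ⟨$⟩ʳ inject≤ (eD.to d) a≤n)) ≡⟨ cong (τ ⟨$⟩ʳ_) (inverseˡ σ) ⟩
    τ ⟨$⟩ʳ inject≤ (eD.to d) a≤n                   ≡⟨ τ-extends (eD.to d) ⟩
    ψ (eD.from (eD.to d))                          ≡⟨ cong ψ (eD.strictlyInverseʳ d) ⟩
    ψ d                                            ∎
    where open ≡-Reasoning

-- Total prime labellings along a chain of edges

gcdList-∣ : ∀ {x xs} → x ∈ xs → gcdList xs ∣ x
gcdList-∣ {xs = y ∷ ys} (here refl) = gcd[m,n]∣m y (gcdList ys)
gcdList-∣ {xs = y ∷ ys} (there x∈) = ∣-trans (gcd[m,n]∣n y (gcdList ys)) (gcdList-∣ x∈)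

consecutive⇒gcdList≡1 : ∀ {x xs} → x ∈ xs → suc x ∈ xs → gcdList xs ≡ 1
consecutive⇒gcdList≡1 {x} {xs} x∈ sx∈ =
  ∣1⇒≡1 (∣m+n∣m⇒∣n (subst (gcdList xs ∣_) (+-comm 1 x) (gcdList-∣ sx∈)) (gcdList-∣ x∈))

module _ (G : Graph) where
  open Graph G using (order; Adj; adj?)

  private
    edge∈ : ∀ {u v} → toℕ u < toℕ v → Adj u v → (u , v) ∈ edgeList G
    edge∈ u<v uv = ∈-filter⁺ (λ p → (proj₁ p Fin.<? proj₂ p) ×-dec adj? (proj₁ p) (proj₂ p))
                             (∈-cartesianProduct⁺ (∈-allFin _) (∈-allFin _)) (u<v , uv)

  edge : ∀ {u v} → toℕ u < toℕ v → Adj u v → Edge G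
  edge u<v uv = index (edge∈ u<v uv)

  endpoints-edge : ∀ {u v} (u<v : toℕ u < toℕ v) (uv : Adj u v) → endpoints G (edge u<v uv) ≡ (u , v)
  endpoints-edge u<v uv = sym (lookup-index (edge∈ u<v uv))

  ∈-incident⁺ : ∀ {v} e → v ≡ proj₁ (endpoints G e) ⊎ v ≡ proj₂ (endpoints G e) → e ∈ incident G v
  ∈-incident⁺ {v} e =
    ∈-filter⁺ (λ e → (v Finₚ.≟ proj₁ (endpoints G e)) ⊎-dec (v Finₚ.≟ proj₂ (endpoints G e))) (∈-allFin e)

  -- The vertices get their labels, the chain edges the m largest labels in chain order, and the
  -- other edges the labels that remain.
  module ChainLabelling {m} (chain : Fin m → Edge G) (chain-inj : Injective _≡_ _≡_ chain)
                        (label : Fin order → ℕ) (label-inj : Injective _≡_ _≡_ label)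
                        (label≥1 : ∀ v → 1 ≤ label v) (label+m≤ : ∀ v → label v + m ≤ order + size G) where

    T : ℕ
    T = order + size G

    m≤T : m ≤ T
    m≤T = ≤-trans (injective⇒≤ chain-inj) (m≤n+m (size G) order)

    label≤ : ∀ v → label v ≤ T ∸ m
    label≤ v = subst (_≤ T ∸ m) (m+n∸n≡m (label v) m) (∸-monoˡ-≤ m (label+m≤ v))

    slot : Fin order ⊎ Fin m → ℕ
    slot (inj₁ v) = pred (label v)
    slot (inj₂ j) = T ∸ m + toℕ j

    suc-pred-label : ∀ v → suc (pred (label v)) ≡ label v
    suc-pred-label v = suc-pred (label v) {{>-nonZero (label≥1 v)}}

    pred-label< : ∀ v → pred (label v) < T ∸ m
    pred-label< v = subst (_≤ T ∸ m) (sym (suc-pred-label v)) (label≤ v)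

    slot< : ∀ d → slot d < T
    slot< (inj₁ v) = <-≤-trans (pred-label< v) (m∸n≤m T m)
    slot< (inj₂ j) = <-≤-trans (+-monoʳ-< (T ∸ m) (toℕ<n j)) (≤-reflexive (m∸n+n≡m m≤T))

    slot-inj : Injective _≡_ _≡_ slot
    slot-inj {inj₁ u} {inj₁ v} eq =
      cong inj₁ (label-inj (trans (sym (suc-pred-label u)) (trans (cong suc eq) (suc-pred-label v))))
    slot-inj {inj₂ i} {inj₂ j} eq = cong inj₂ (toℕ-injective (+-cancelˡ-≡ (T ∸ m) _ _ eq))
    slot-inj {inj₁ u} {inj₂ j} eq = contradiction eq (<⇒≢ (<-≤-trans (pred-label< u) (m≤m+n (T ∸ m) (toℕ j))))
    slot-inj {inj₂ j} {inj₁ u} eq = contradiction (sym eq) (<⇒≢ (<-≤-trans (pred-label< u) (m≤m+n (T ∸ m) (toℕ j))))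

    ι : Fin order ⊎ Fin m → Fin order ⊎ Edge G
    ι = Sum.map₂ chain

    ι-inj : Injective _≡_ _≡_ ι
    ι-inj {inj₁ u} {inj₁ v} eq = cong inj₁ (inj₁-injective eq)
    ι-inj {inj₂ i} {inj₂ j} eq = cong inj₂ (chain-inj (inj₂-injective eq))

    ψ : Fin order ⊎ Fin m → Fin T
    ψ d = fromℕ< (slot< d)

    ψ-inj : Injective _≡_ _≡_ ψ
    ψ-inj {c} {d} eq = slot-inj (trans (sym (toℕ-fromℕ< (slot< c))) (trans (cong toℕ eq) (toℕ-fromℕ< (slot< d))))

    extension : Σ[ f ∈ (Fin order ⊎ Edge G) ↔ Fin T ] ∀ d → Inverse.to f (ι d) ≡ ψ d
    extension = extendToBijection (↔-sym +↔⊎) (↔-sym +↔⊎) ι ι-inj ψ ψ-inj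

    labelling : (Fin order ⊎ Edge G) ↔ Fin T
    labelling = proj₁ extension

    ℓ : Fin order ⊎ Edge G → ℕ
    ℓ x = suc (toℕ (Inverse.to labelling x))

    ℓ∘ι : ∀ d → ℓ (ι d) ≡ suc (slot d)
    ℓ∘ι d = cong suc (trans (cong toℕ (proj₂ extension d)) (toℕ-fromℕ< (slot< d)))

    ℓ-vertex : ∀ v → ℓ (inj₁ v) ≡ label v
    ℓ-vertex v = trans (ℓ∘ι (inj₁ v)) (suc-pred-label v)

    ℓ-chain : ∀ j → ℓ (inj₂ (chain j)) ≡ suc (T ∸ m + toℕ j)
    ℓ-chain j = ℓ∘ι (inj₂ j)

  totalPrime-fromChain : ∀ {m} (chain : Fin m → Edge G) → Injective _≡_ _≡_ chain →
    (∀ v → ∃₂ λ i j → toℕ j ≡ suc (toℕ i) × chain i ∈ incident G v × chain j ∈ incident G v) →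
    (label : Fin order → ℕ) → Injective _≡_ _≡_ label →
    (∀ v → 1 ≤ label v) → (∀ v → label v + m ≤ order + size G) →
    (∀ u v → Adj u v → Coprime (label u) (label v)) → TotalPrime G
  totalPrime-fromChain {m} chain chain-inj chain-covers label label-inj label≥1 label+m≤ coprime = record
    { lab        = ↔⇒⤖ labelling
    ; vertexCond = λ u v uv → subst₂ Coprime (sym (ℓ-vertex u)) (sym (ℓ-vertex v)) (coprime u v uv)
    ; edgeCond   = λ v _ → edgeCond v
    }
    where
    open ChainLabelling chain chain-inj label label-inj label≥1 label+m≤

    edgeCond : ∀ v → gcdList (map (ℓ ∘ inj₂) (incident G v)) ≡ 1
    edgeCond v with i , j , j≡1+i , i∈ , j∈ ← chain-covers v =
      consecutive⇒gcdList≡1 (subst (_∈ labels) (ℓ-chain i) (∈-map⁺ (ℓ ∘ inj₂) i∈))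
                            (subst (_∈ labels) ℓj≡ (∈-map⁺ (ℓ ∘ inj₂) j∈))
      where
      labels : List ℕ
      labels = map (ℓ ∘ inj₂) (incident G v)

      ℓj≡ : ℓ (inj₂ (chain j)) ≡ suc (suc (T ∸ m + toℕ i))
      ℓj≡ = trans (ℓ-chain j) (cong suc (trans (cong (T ∸ m +_) j≡1+i) (+-suc (T ∸ m) (toℕ i))))

-- The windmill K_{k+1}^(2)

block-< : ∀ {k a} → a < k → block k a ≡ 0
block-< {suc k} a<k = m<n⇒m/n≡0 a<k

block-+ : ∀ {k a} → a < k → block k (k + a) ≡ 1
block-+ {suc k} {a} a<k = begin
  (suc k + a) / suc k               ≡⟨ m/n≡1+[m∸n]/n (m≤m+n (suc k) a) ⟩
  suc ((suc k + a ∸ suc k) / suc k) ≡⟨ cong (λ x → suc (x / suc k)) (m+n∸m≡n (suc k) a) ⟩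
  suc (a / suc k)                   ≡⟨ cong suc (m<n⇒m/n≡0 a<k) ⟩
  1                                 ∎
  where open ≡-Reasoning

toℕ²-injective : ∀ {m n} {x y : Fin m × Fin n} → Prod.map toℕ toℕ x ≡ Prod.map toℕ toℕ y → x ≡ y
toℕ²-injective {x = _ , _} {_ , _} eq = cong₂ _,_ (toℕ-injective (cong proj₁ eq)) (toℕ-injective (cong proj₂ eq))

module Windmill (k : ℕ) where

  G : Graph
  G = windmill (suc k) 2

  ends : Edge G → ℕ × ℕ
  ends = Prod.map toℕ toℕ ∘ endpoints G

  record IsEdge (e : ℕ × ℕ) : Set where
    field
      lo<hi : proj₁ e < proj₂ e
      hi≤2k : proj₂ e ≤ 2 * k
      sameBlock : proj₁ e ≡ 0 ⊎ block k (proj₁ e ∸ 1) ≡ block k (proj₂ e ∸ 1)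

  module _ {e : ℕ × ℕ} (l : IsEdge e) where
    open IsEdge l

    private
      u v : Fin (suc (2 * k))
      u = fromℕ< (≤-trans lo<hi (m≤n⇒m≤1+n hi≤2k))
      v = fromℕ< (s≤s hi≤2k)

      toℕ-u : toℕ u ≡ proj₁ e
      toℕ-u = toℕ-fromℕ< _

      toℕ-v : toℕ v ≡ proj₂ e
      toℕ-v = toℕ-fromℕ< _

      u<v : toℕ u < toℕ v
      u<v = subst₂ _<_ (sym toℕ-u) (sym toℕ-v) lo<hi

      adjacent : Graph.Adj G u v
      adjacent with sameBlock
      ... | inj₁ lo≡0 = (λ u≡v → <⇒≢ u<v (cong toℕ u≡v)) , inj₁ (inj₁ (trans toℕ-u lo≡0))
      ... | inj₂ same = (λ u≡v → <⇒≢ u<v (cong toℕ u≡v)) ,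
                        inj₂ (subst₂ (λ x y → block k (x ∸ 1) ≡ block k (y ∸ 1)) (sym toℕ-u) (sym toℕ-v) same)

    toEdge : Edge G
    toEdge = edge G u<v adjacent

    ends-toEdge : ends toEdge ≡ e
    ends-toEdge = trans (cong (Prod.map toℕ toℕ) (endpoints-edge G u<v adjacent)) (cong₂ _,_ toℕ-u toℕ-v)

  -- Copy q of K_{k+1} consists of the centre 0 at position 0 and the vertices q·k + p at positions
  -- p = 1, …, k.
  vertexAt : Fin 2 → ℕ → ℕ
  vertexAt _  zero    = 0
  vertexAt 0F (suc p) = suc p
  vertexAt 1F (suc p) = suc (k + p)

  inCopy : Fin 2 → ℕ × ℕ → ℕ × ℕ
  inCopy q = Prod.map (vertexAt q) (vertexAt q)

  vertexAt-< : ∀ q {p p′} → p < p′ → vertexAt q p < vertexAt q p′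
  vertexAt-< 0F {zero}  {suc p′} _         = s≤s z≤n
  vertexAt-< 1F {zero}  {suc p′} _         = s≤s z≤n
  vertexAt-< 0F {suc p} {suc p′} p<p′      = p<p′
  vertexAt-< 1F {suc p} {suc p′} (s≤s p<p′) = s≤s (+-monoʳ-< k p<p′)

  vertexAt-≤ : ∀ q {p} → p ≤ k → vertexAt q p ≤ 2 * k
  vertexAt-≤ q  {zero}  _   = z≤n
  vertexAt-≤ 0F {suc p} p≤k = ≤-trans p≤k (m≤m+n k (k + 0))
  vertexAt-≤ 1F {suc p} p≤k =
    subst (suc (k + p) ≤_) (cong (k +_) (sym (+-identityʳ k))) (subst (_≤ k + k) (+-suc k p) (+-monoʳ-≤ k p≤k))

  block-vertexAt : ∀ q {p} → p < k → block k (vertexAt q (suc p) ∸ 1) ≡ toℕ q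
  block-vertexAt 0F = block-<
  block-vertexAt 1F = block-+

  isEdge-inCopy : ∀ q {p p′} → p < p′ → p′ ≤ k → IsEdge (inCopy q (p , p′))
  isEdge-inCopy q {p} {p′} p<p′ p′≤k = record
    { lo<hi     = vertexAt-< q p<p′
    ; hi≤2k     = vertexAt-≤ q p′≤k
    ; sameBlock = sameBlock p p′ p<p′ p′≤k
    }
    where
    sameBlock : ∀ p p′ → p < p′ → p′ ≤ k → vertexAt q p ≡ 0 ⊎ block k (vertexAt q p ∸ 1) ≡ block k (vertexAt q p′ ∸ 1)
    sameBlock zero    _        _          _   = inj₁ refl
    sameBlock (suc p) (suc p′) (s≤s p<p′) p′≤k =
      inj₂ (trans (block-vertexAt q (<-trans p<p′ p′≤k)) (sym (block-vertexAt q p′≤k)))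

  position : Fin 2 → ℕ → ℕ
  position 0F x = x
  position 1F x = x ∸ k

  position-vertexAt : ∀ q p → position q (vertexAt q p) ≡ p
  position-vertexAt 0F zero    = refl
  position-vertexAt 0F (suc p) = refl
  position-vertexAt 1F zero    = 0∸n≡0 k
  position-vertexAt 1F (suc p) = trans (cong (_∸ k) (sym (+-suc k p))) (m+n∸m≡n k (suc p))

  copyOf : ℕ → Fin 2
  copyOf y with y ≤? k
  ... | yes _ = 0F
  ... | no  _ = 1F

  copyOf-vertexAt : ∀ q {p} → 0 < p → p ≤ k → copyOf (vertexAt q p) ≡ q
  copyOf-vertexAt 0F {suc p} _ p≤k with suc p ≤? k
  ... | yes _   = refl
  ... | no  p≰k = contradiction p≤k p≰k
  copyOf-vertexAt 1F {suc p} _ _   with suc (k + p) ≤? k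
  ... | yes k+p<k = contradiction k+p<k (<⇒≱ (s≤s (m≤m+n k p)))
  ... | no  _     = refl

  vertexAt-0F : ∀ p → vertexAt 0F p ≡ p
  vertexAt-0F zero    = refl
  vertexAt-0F (suc p) = refl

  pairEnds : Fin k × Fin (suc k) → ℕ × ℕ
  pairEnds (a , b) with toℕ b ≤? toℕ a
  ... | yes _ = inCopy 0F (toℕ b , suc (toℕ a))
  ... | no  _ = inCopy 1F (toℕ a , toℕ b)

  isEdge-pairEnds : ∀ ab → IsEdge (pairEnds ab)
  isEdge-pairEnds (a , b) with toℕ b ≤? toℕ a
  ... | yes b≤a = isEdge-inCopy 0F (s≤s b≤a) (toℕ<n a)
  ... | no  b≰a = isEdge-inCopy 1F (≰⇒> b≰a) (≤-pred (toℕ<n b))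

  unpair : ℕ × ℕ → ℕ × ℕ
  unpair (x , y) with copyOf y
  ... | 0F = pred y , x
  ... | 1F = position 1F x , position 1F y

  unpair-pairEnds : ∀ ab → unpair (pairEnds ab) ≡ Prod.map toℕ toℕ ab
  unpair-pairEnds (a , b) with toℕ b ≤? toℕ a
  ... | yes b≤a rewrite copyOf-vertexAt 0F (s≤s z≤n) (toℕ<n a) = cong (toℕ a ,_) (vertexAt-0F (toℕ b))
  ... | no  b≰a rewrite copyOf-vertexAt 1F (<-≤-trans (s≤s z≤n) (≰⇒> b≰a)) (≤-pred (toℕ<n b)) =
    cong₂ _,_ (position-vertexAt 1F (toℕ a)) (position-vertexAt 1F (toℕ b))

  k*[1+k]≤size : k * suc k ≤ size G
  k*[1+k]≤size = injective⇒≤ {f = λ i → toEdge (isEdge-pairEnds (remQuot {k} (suc k) i))} injective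
    where
    injective : ∀ {i j} → toEdge (isEdge-pairEnds (remQuot {k} (suc k) i)) ≡ toEdge (isEdge-pairEnds (remQuot {k} (suc k) j)) → i ≡ j
    injective {i} {j} eq = begin
      i                                    ≡⟨ sym (combine-remQuot {k} (suc k) i) ⟩
      uncurry combine (remQuot {k} (suc k) i) ≡⟨ cong (uncurry combine) remQuot≡ ⟩
      uncurry combine (remQuot {k} (suc k) j) ≡⟨ combine-remQuot {k} (suc k) j ⟩
      j                                    ∎
      where
      open ≡-Reasoning
      pairEnds≡ : pairEnds (remQuot {k} (suc k) i) ≡ pairEnds (remQuot {k} (suc k) j)
      pairEnds≡ = trans (sym (ends-toEdge (isEdge-pairEnds _))) (trans (cong ends eq) (ends-toEdge (isEdge-pairEnds _)))
      remQuot≡ : remQuot {k} (suc k) i ≡ remQuot {k} (suc k) j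
      remQuot≡ = toℕ²-injective (trans (sym (unpair-pairEnds _)) (trans (cong unpair pairEnds≡) (unpair-pairEnds _)))

  -- The c-th edge, as a pair of positions, of the cycle 0, 1, …, k, 0 through a copy.
  cycle : ℕ → ℕ × ℕ
  cycle c with suc c ≤? k
  ... | yes _ = c , suc c
  ... | no  _ = 0 , k

  cycle-lo<hi : ∀ c → 0 < k → proj₁ (cycle c) < proj₂ (cycle c)
  cycle-lo<hi c 0<k with suc c ≤? k
  ... | yes _ = n<1+n c
  ... | no  _ = 0<k

  cycle-hi≤k : ∀ c → 0 < k → proj₂ (cycle c) ≤ k
  cycle-hi≤k c 0<k with suc c ≤? k
  ... | yes c<k = c<k
  ... | no  _   = ≤-refl

  cycle₀-lo : proj₁ (cycle 0) ≡ 0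
  cycle₀-lo with 1 ≤? k
  ... | yes _ = refl
  ... | no  _ = refl

  cycleₖ-lo : proj₁ (cycle k) ≡ 0
  cycleₖ-lo with suc k ≤? k
  ... | yes k<k = contradiction k<k (<-irrefl refl)
  ... | no  _   = refl

  cycle-hi : ∀ {p} → p < k → proj₂ (cycle p) ≡ suc p
  cycle-hi {p} p<k with suc p ≤? k
  ... | yes _   = refl
  ... | no  p≮k = contradiction p<k p≮k

  cycle-next : ∀ {p} → p < k → suc p ≡ proj₁ (cycle (suc p)) ⊎ suc p ≡ proj₂ (cycle (suc p))
  cycle-next {p} p<k with suc (suc p) ≤? k
  ... | yes _   = inj₁ refl
  ... | no  p≮k = inj₂ (≤∧≮⇒≡ p<k p≮k)

  cycleIndex : ℕ × ℕ → ℕ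
  cycleIndex (zero  , y) with y ≟ k
  ... | yes _ = k
  ... | no  _ = 0
  cycleIndex (suc x , _) = suc x

  cycleIndex-cycle : 2 ≤ k → ∀ {c} → c ≤ k → cycleIndex (cycle c) ≡ c
  cycleIndex-cycle 2≤k {c} c≤k with suc c ≤? k
  cycleIndex-cycle 2≤k {zero} c≤k | yes _ with 1 ≟ k
  ... | yes 1≡k = contradiction (subst (2 ≤_) (sym 1≡k) 2≤k) λ { (s≤s ()) }
  ... | no  _   = refl
  cycleIndex-cycle 2≤k {suc c} c≤k | yes _ = refl
  cycleIndex-cycle 2≤k {c} c≤k | no c≮k with k ≟ k
  ... | yes _   = sym (≤∧≮⇒≡ c≤k c≮k)
  ... | no  k≢k = contradiction refl k≢k

  chainEnds : Fin 2 × Fin (suc k) → ℕ × ℕ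
  chainEnds (q , c) = inCopy q (cycle (toℕ c))

  chainIndex : ℕ × ℕ → ℕ × ℕ
  chainIndex (x , y) = toℕ (copyOf y) , cycleIndex (position (copyOf y) x , position (copyOf y) y)

  endpoint⇒incident : ∀ {v} e → toℕ v ≡ proj₁ (ends e) ⊎ toℕ v ≡ proj₂ (ends e) → e ∈ incident G v
  endpoint⇒incident e (inj₁ v≡lo) = ∈-incident⁺ G e (inj₁ (toℕ-injective v≡lo))
  endpoint⇒incident e (inj₂ v≡hi) = ∈-incident⁺ G e (inj₂ (toℕ-injective v≡hi))

  vertex-view : ∀ (v : Fin (suc (2 * k))) → toℕ v ≡ 0 ⊎ Σ[ q ∈ Fin 2 ] Σ[ p ∈ ℕ ] p < k × toℕ v ≡ vertexAt q (suc p)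
  vertex-view v with toℕ v in eq
  ... | zero  = inj₁ refl
  ... | suc x with suc x ≤? k
  ...   | yes x<k = inj₂ (0F , x , x<k , refl)
  ...   | no  x≮k = inj₂ (1F , x ∸ k , x∸k<k , cong suc (sym (m+[n∸m]≡n k≤x)))
    where
    k≤x : k ≤ x
    k≤x = ≤-pred (≰⇒> x≮k)
    x∸k<k : x ∸ k < k
    x∸k<k = subst (x ∸ k <_) (m+n∸m≡n k k) (∸-monoˡ-< x<k+k k≤x)
      where
      x<k+k : x < k + k
      x<k+k = subst (λ n → x < k + n) (+-identityʳ k) (≤-pred (subst (_< suc (2 * k)) eq (toℕ<n v)))

  module Chain (2≤k : 2 ≤ k) where

    0<k : 0 < k
    0<k = ≤-trans (s≤s z≤n) 2≤k

    isEdge-chainEnds : ∀ qc → IsEdge (chainEnds qc)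
    isEdge-chainEnds (q , c) = isEdge-inCopy q (cycle-lo<hi (toℕ c) 0<k) (cycle-hi≤k (toℕ c) 0<k)

    -- Index q·(k + 1) + c is the c-th cycle edge of copy q, so the chain follows the closed walk
    -- 0, 1, …, k, 0, k + 1, …, 2k, 0.
    chain : Fin (2 * suc k) → Edge G
    chain j = toEdge (isEdge-chainEnds (remQuot {2} (suc k) j))

    chainIndex-chainEnds : ∀ qc → chainIndex (chainEnds qc) ≡ Prod.map toℕ toℕ qc
    chainIndex-chainEnds (q , c)
      rewrite copyOf-vertexAt q (<-≤-trans (s≤s z≤n) (cycle-lo<hi (toℕ c) 0<k)) (cycle-hi≤k (toℕ c) 0<k)
            | position-vertexAt q (proj₁ (cycle (toℕ c)))
            | position-vertexAt q (proj₂ (cycle (toℕ c)))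
            = cong (toℕ q ,_) (cycleIndex-cycle 2≤k (≤-pred (toℕ<n c)))

    chain-injective : Injective _≡_ _≡_ chain
    chain-injective {i} {j} eq = begin
      i                                     ≡⟨ sym (combine-remQuot {2} (suc k) i) ⟩
      uncurry combine (remQuot {2} (suc k) i) ≡⟨ cong (uncurry combine) remQuot≡ ⟩
      uncurry combine (remQuot {2} (suc k) j) ≡⟨ combine-remQuot {2} (suc k) j ⟩
      j                                     ∎
      where
      open ≡-Reasoning
      chainEnds≡ : chainEnds (remQuot {2} (suc k) i) ≡ chainEnds (remQuot {2} (suc k) j)
      chainEnds≡ = trans (sym (ends-toEdge (isEdge-chainEnds _))) (trans (cong ends eq) (ends-toEdge (isEdge-chainEnds _)))
      remQuot-toℕ≡ : Prod.map toℕ toℕ (remQuot {2} (suc k) i) ≡ Prod.map toℕ toℕ (remQuot {2} (suc k) j)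
      remQuot-toℕ≡ = trans (sym (chainIndex-chainEnds _)) (trans (cong chainIndex chainEnds≡) (chainIndex-chainEnds _))
      remQuot≡ : remQuot {2} (suc k) i ≡ remQuot {2} (suc k) j
      remQuot≡ = toℕ²-injective remQuot-toℕ≡

    ends-chain : ∀ q c → ends (chain (combine q c)) ≡ chainEnds (q , c)
    ends-chain q c = trans (ends-toEdge (isEdge-chainEnds _)) (cong chainEnds (remQuot-combine q c))

    chain-incident : ∀ {v} q c {x} → toℕ v ≡ vertexAt q x →
                     x ≡ proj₁ (cycle (toℕ c)) ⊎ x ≡ proj₂ (cycle (toℕ c)) → chain (combine q c) ∈ incident G v
    chain-incident q c v≡ (inj₁ x≡lo) =
      endpoint⇒incident _ (inj₁ (trans v≡ (trans (cong (vertexAt q) x≡lo) (sym (cong proj₁ (ends-chain q c))))))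
    chain-incident q c v≡ (inj₂ x≡hi) =
      endpoint⇒incident _ (inj₂ (trans v≡ (trans (cong (vertexAt q) x≡hi) (sym (cong proj₂ (ends-chain q c))))))

    Covered : Fin (suc (2 * k)) → Set
    Covered v = ∃₂ λ i j → toℕ j ≡ suc (toℕ i) × chain i ∈ incident G v × chain j ∈ incident G v

    centre-covered : ∀ {v} → toℕ v ≡ 0 → Covered v
    centre-covered {v} v≡0 =
      combine {2} 0F (Fin.fromℕ k) , combine {2} 1F zero , consecutive ,
      chain-incident {v} 0F (Fin.fromℕ k) v≡0 (inj₁ (sym (trans (cong (proj₁ ∘ cycle) (Finₚ.toℕ-fromℕ k)) cycleₖ-lo))) ,
      chain-incident 1F zero v≡0 (inj₁ (sym cycle₀-lo))
      where
      consecutive : toℕ (combine {2} 1F (zero {k})) ≡ suc (toℕ (combine {2} 0F (Fin.fromℕ k)))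
      consecutive = begin
        toℕ (combine {2} 1F (zero {k}))              ≡⟨ toℕ-combine {2} 1F (zero {k}) ⟩
        suc k * 1 + 0                                ≡⟨ trans (+-identityʳ _) (*-identityʳ (suc k)) ⟩
        suc k                                        ≡⟨ cong suc (cong₂ _+_ (*-zeroʳ (suc k)) (Finₚ.toℕ-fromℕ k)) ⟨
        suc (suc k * 0 + toℕ (Fin.fromℕ k))          ≡⟨ cong suc (toℕ-combine {2} 0F (Fin.fromℕ k)) ⟨
        suc (toℕ (combine {2} 0F (Fin.fromℕ k)))      ∎
        where open ≡-Reasoning

    position-covered : ∀ {v} q {p} → p < k → toℕ v ≡ vertexAt q (suc p) → Covered v
    position-covered {v} q {p} p<k v≡ =
      combine q c , combine q c′ , consecutive ,
      chain-incident q c v≡ (inj₂ (sym (trans (cong (proj₂ ∘ cycle) (toℕ-fromℕ< _)) (cycle-hi p<k)))) ,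
      chain-incident q c′ v≡ (subst (λ x → suc p ≡ proj₁ (cycle x) ⊎ suc p ≡ proj₂ (cycle x))
                                    (sym (toℕ-fromℕ< (s≤s p<k))) (cycle-next p<k))
      where
      c c′ : Fin (suc k)
      c  = fromℕ< (m<n⇒m<1+n p<k)
      c′ = fromℕ< (s≤s p<k)
      consecutive : toℕ (combine q c′) ≡ suc (toℕ (combine q c))
      consecutive = begin
        toℕ (combine q c′)            ≡⟨ toℕ-combine q c′ ⟩
        suc k * toℕ q + toℕ c′        ≡⟨ cong (suc k * toℕ q +_) (toℕ-fromℕ< (s≤s p<k)) ⟩
        suc k * toℕ q + suc p         ≡⟨ +-suc _ p ⟩
        suc (suc k * toℕ q + p)       ≡⟨ cong (λ x → suc (suc k * toℕ q + x)) (sym (toℕ-fromℕ< _)) ⟩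
        suc (suc k * toℕ q + toℕ c)   ≡⟨ cong suc (sym (toℕ-combine q c)) ⟩
        suc (toℕ (combine q c))       ∎
        where open ≡-Reasoning

    chain-covers : ∀ v → Covered v
    chain-covers v = [ centre-covered , (λ (q , p , p<k , v≡) → position-covered q p<k v≡) ]′ (vertex-view v)

    totalPrime-fromLabels : (label : Fin (suc (2 * k)) → ℕ) → Injective _≡_ _≡_ label →
                          (∀ v → 1 ≤ label v) → (∀ v → label v < k * suc k) →
                          (∀ u v → Graph.Adj G u v → Coprime (label u) (label v)) → TotalPrime G
    totalPrime-fromLabels label label-inj label≥1 label< =
      totalPrime-fromChain G chain chain-injective chain-covers label label-inj label≥1 fits
      where
      fits : ∀ v → label v + 2 * suc k ≤ suc (2 * k) + size G
      fits v = begin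
        label v + 2 * suc k          ≡⟨ cong (label v +_) (*-suc 2 k) ⟩
        label v + suc (suc (2 * k))  ≡⟨ +-suc (label v) (suc (2 * k)) ⟩
        suc (label v) + suc (2 * k)  ≤⟨ +-monoˡ-≤ (suc (2 * k)) (≤-trans (label< v) k*[1+k]≤size) ⟩
        size G + suc (2 * k)         ≡⟨ +-comm (size G) (suc (2 * k)) ⟩
        suc (2 * k) + size G         ∎
        where open ≤-Reasoning

-- Counting primes

primesUpTo : ℕ → List ℕ
primesUpTo n = filter prime? (downFrom (suc n))

π : ℕ → ℕ
π n = length (primesUpTo n)

primesUpTo-prime : ∀ n → All Prime (primesUpTo n)
primesUpTo-prime n = Allₚ.all-filter prime? (downFrom (suc n))

primesUpTo-≤ : ∀ n → All (_≤ n) (primesUpTo n)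
primesUpTo-≤ n = Allₚ.filter⁺ prime? (Allₚ.applyDownFrom⁺₁ (λ i → i) (suc n) ≤-pred)

primesUpTo-unique : ∀ n → Unique (primesUpTo n)
primesUpTo-unique n = Uniqueₚ.filter⁺ prime? (Uniqueₚ.downFrom⁺ (suc n))

prime≥2 : ∀ {p} → Prime p → 2 ≤ p
prime≥2 {p} pp = ℕ.nonTrivial⇒n>1 p {{prime⇒nonTrivial pp}}

prime∤1 : ∀ {p} → Prime p → ¬ p ∣ 1
prime∤1 pp p∣1 = <⇒≢ (prime≥2 pp) (sym (∣1⇒≡1 p∣1))

primeDivisor : ∀ {n} → 2 ≤ n → ∃ λ p → Prime p × p ∣ n
primeDivisor {1} (s≤s ())
primeDivisor {n@(suc (suc _))} _ with PrimeFactorisation.factors (factorise n)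
                                    | PrimeFactorisation.isFactorisation (factorise n)
                                    | PrimeFactorisation.factorsPrime (factorise n)
... | f ∷ fs | n≡f*Πfs | pf ∷ _ = f , pf , divides (product fs) (trans n≡f*Πfs (*-comm f (product fs)))

maximalPower : ∀ {p} → 2 ≤ p → ∀ {n} → 1 ≤ n → ∃₂ λ e m → n ≡ p ^ e * m × ¬ p ∣ m
maximalPower {p} 2≤p = go (<-wellFounded _)
  where
  go : ∀ {n} → Acc _<_ n → 1 ≤ n → ∃₂ λ e m → n ≡ p ^ e * m × ¬ p ∣ m
  go {n} (acc rec) n≥1 with p ∣? n
  ... | no  p∤n = 0 , n , sym (+-identityʳ n) , p∤n
  ... | yes (divides zero    n≡0) = contradiction n≡0 (≢-sym (<⇒≢ n≥1))
  ... | yes (divides (suc q) n≡q*p) with go (rec (subst (suc q <_) (sym n≡q*p) (m<m*n (suc q) p 2≤p))) (s≤s z≤n)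
  ...   | e , m , q≡ , p∤m = suc e , m , n≡ , p∤m
    where
    n≡ : n ≡ p ^ suc e * m
    n≡ = begin
      n                  ≡⟨ n≡q*p ⟩
      suc q * p          ≡⟨ cong (_* p) q≡ ⟩
      p ^ e * m * p      ≡⟨ *-comm (p ^ e * m) p ⟩
      p * (p ^ e * m)    ≡⟨ *-assoc p (p ^ e) m ⟨
      p ^ suc e * m      ∎
      where open ≡-Reasoning

smooth-bound : ∀ K {B n} → 1 ≤ n → (∀ {p} → Prime p → p ∣ n → p ≤ K) →
               (∀ {p} e → Prime p → p ^ e ∣ n → p ^ e ≤ B) → n ≤ B ^ π K
smooth-bound zero {n = n} n≥1 small _ with n ≤? 1
... | yes n≤1 = n≤1
... | no  n≰1 with p , pp , p∣n ← primeDivisor (≰⇒> n≰1) =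
  contradiction (small pp p∣n) (<⇒≱ (≤-trans (s≤s z≤n) (prime≥2 pp)))
smooth-bound (suc K) {B} {n} n≥1 small powers with prime? (suc K)
... | no ¬prime = smooth-bound K n≥1 (λ pp p∣n → ≤-pred (≤∧≢⇒< (small pp p∣n) λ { refl → ¬prime pp })) powers
... | yes 1+K-prime with e , m , n≡ , p∤m ← maximalPower (prime≥2 1+K-prime) n≥1 = begin
  n               ≡⟨ n≡ ⟩
  suc K ^ e * m   ≤⟨ *-mono-≤ (powers e 1+K-prime (divides m (trans n≡ (*-comm _ m)))) (smooth-bound K m≥1 small′ powers′) ⟩
  B * B ^ π K     ∎
  where
  open ≤-Reasoning
  m∣n : m ∣ n
  m∣n = divides (suc K ^ e) n≡
  m≥1 : 1 ≤ m
  m≥1 = n≢0⇒n>0 λ { refl → <⇒≢ n≥1 (sym (trans n≡ (*-zeroʳ (suc K ^ e)))) }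
  small′ : ∀ {p} → Prime p → p ∣ m → p ≤ K
  small′ pp p∣m = ≤-pred (≤∧≢⇒< (small pp (∣-trans p∣m m∣n)) λ { refl → p∤m p∣m })
  powers′ : ∀ {p} e → Prime p → p ^ e ∣ m → p ^ e ≤ B
  powers′ e pp pᵉ∣m = powers e pp (∣-trans pᵉ∣m m∣n)

[n/2]![n/2]!∣n! : ∀ n → (n / 2) ! * (n / 2) ! ∣ n !
[n/2]![n/2]!∣n! n = ∣-trans (*-monoʳ-∣ (h !) (m≤n⇒m!∣n! h≤n∸h)) (k![n∸k]!∣n! (m/n≤m n 2))
  where
  h : ℕ
  h = n / 2
  h≤n∸h : h ≤ n ∸ h
  h≤n∸h = subst (_≤ n ∸ h) (m+n∸n≡m h h)
            (∸-monoˡ-≤ h (subst (_≤ n) (trans (*-comm h 2) (cong (h +_) (+-identityʳ h))) (m/n*n≤m n 2)))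

module _ {p} (pp : Prime p) where

  private instance
    p≢0 : NonZero p
    p≢0 = prime⇒nonZero pp

  ∤-* : ∀ {m n} → ¬ p ∣ m → ¬ p ∣ n → ¬ p ∣ m * n
  ∤-* p∤m p∤n p∣mn = [ p∤m , p∤n ]′ (euclidsLemma _ _ pp p∣mn)

  factorial-block : ∀ q r → r < p → ∃ λ W → ¬ p ∣ W × (r + q * p) ! ≡ (q * p) ! * W
  factorial-block q zero    _   = 1 , prime∤1 pp , sym (*-identityʳ _)
  factorial-block q (suc r) r<p with W , p∤W , eq ← factorial-block q r (<-trans (n<1+n r) r<p) =
    suc (r + q * p) * W , ∤-* p∤ p∤W , trans (cong (suc (r + q * p) *_) eq) (x∙yz≈y∙xz (suc (r + q * p)) ((q * p) !) W)
    where
    p∤ : ¬ p ∣ suc r + q * p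
    p∤ p∣ = <⇒≱ r<p (∣⇒≤ (∣m+n∣m⇒∣n (subst (p ∣_) (+-comm (suc r) (q * p)) p∣) (n∣m*n q)))

  factorial-multiple : ∀ q → ∃ λ U → ¬ p ∣ U × (q * p) ! ≡ p ^ q * q ! * U
  factorial-multiple zero = 1 , prime∤1 pp , refl
  factorial-multiple (suc q) with U , p∤U , eqU ← factorial-multiple q
                               | W , p∤W , eqW ← factorial-block q (pred p) (≤-reflexive (suc-pred p)) = U * W , ∤-* p∤U p∤W , (begin
    (p + q * p) !                                ≡⟨ cong (λ x → (x + q * p) !) (sym (suc-pred p)) ⟩
    suc (pred p + q * p) * (pred p + q * p) !    ≡⟨ cong₂ _*_ (cong (_+ q * p) (suc-pred p)) (trans eqW (cong (_* W) eqU)) ⟩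
    (p + q * p) * (p ^ q * q ! * U * W)          ≡⟨ rearrange p q (p ^ q) (q !) U W ⟩
    p * p ^ q * (q ! + q * q !) * (U * W)        ∎)
    where
    open ≡-Reasoning
    rearrange : ∀ p q a f u w → (p + q * p) * (a * f * u * w) ≡ p * a * (f + q * f) * (u * w)
    rearrange = solve-∀

  factorial-split : ∀ n → ∃ λ U → ¬ p ∣ U × n ! ≡ p ^ (n / p) * (n / p) ! * U
  factorial-split n with W , p∤W , eqW ← factorial-block (n / p) (n % p) (m%n<n n p)
                       | U , p∤U , eqU ← factorial-multiple (n / p) = U * W , ∤-* p∤U p∤W , (begin
    n !                                    ≡⟨ cong _! (m≡m%n+[m/n]*n n p) ⟩
    (n % p + n / p * p) !                  ≡⟨ eqW ⟩
    (n / p * p) ! * W                      ≡⟨ cong (_* W) eqU ⟩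
    p ^ (n / p) * (n / p) ! * U * W        ≡⟨ *-assoc (p ^ (n / p) * (n / p) !) U W ⟩
    p ^ (n / p) * (n / p) ! * (U * W)      ∎)
    where open ≡-Reasoning

  prime^∣-cancelʳ : ∀ {m n} e → ¬ p ∣ n → p ^ e ∣ m * n → p ^ e ∣ m
  prime^∣-cancelʳ {m} zero _ _ = 1∣ m
  prime^∣-cancelʳ {m} {n} (suc e) p∤n pᵉ⁺¹∣mn with euclidsLemma m n pp (∣-trans (m∣m*n (p ^ e)) pᵉ⁺¹∣mn)
  ... | inj₂ p∣n = contradiction p∣n p∤n
  ... | inj₁ (divides m′ refl) = subst (p ^ suc e ∣_) (*-comm p m′) (*-monoʳ-∣ p (prime^∣-cancelʳ e p∤n pᵉ∣m′n))
    where
    pᵉ∣m′n : p ^ e ∣ m′ * n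
    pᵉ∣m′n = *-cancelˡ-∣ p (subst (p ^ suc e ∣_) (trans (*-assoc m′ p n) (x∙yz≈y∙xz m′ p n)) pᵉ⁺¹∣mn)

  halves-commute : ∀ n → n / 2 / p ≡ n / p / 2
  halves-commute n = begin
    n / 2 / p    ≡⟨ m/n/o≡m/[n*o] n 2 p ⟩
    n / (2 * p)  ≡⟨ /-congʳ (*-comm 2 p) ⟩
    n / (p * 2)  ≡⟨ m/n/o≡m/[n*o] n p 2 ⟨
    n / p / 2    ∎
    where
    open ≡-Reasoning
    instance
      2p≢0 : NonZero (2 * p)
      2p≢0 = m*n≢0 2 p
      p2≢0 : NonZero (p * 2)
      p2≢0 = m*n≢0 p 2

  -- The p-parts of a! and ⌊a/2⌋!² (factorial-split) differ by the exponent ⌊a/p⌋ - 2⌊a/(2p)⌋ = ⌊a/p⌋ mod 2.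
  central-reduce : ∀ a {X} → a ! ≡ X * ((a / 2) ! * (a / 2) !) →
                 ∃₂ λ X′ U → (a / p) ! ≡ X′ * ((a / p / 2) ! * (a / p / 2) !) × ¬ p ∣ U × X ∣ p ^ (a / p % 2) * X′ * U
  central-reduce a {X} a!≡
    with divides X′ a′!≡ ← [n/2]![n/2]!∣n! (a / p)
       | Uₐ , p∤Uₐ , a!-split ← factorial-split a
       | U₂ , _ , [a/2]!-split ← factorial-split (a / 2)
    = X′ , Uₐ , a′!≡ , p∤Uₐ , divides (U₂ * U₂) (trans (sym key) (*-comm X (U₂ * U₂)))
    where
    open ≡-Reasoning
    a′ b′ t P F C : ℕ
    a′ = a / p
    b′ = a′ / 2
    t  = a′ % 2
    P  = p ^ b′
    F  = b′ !
    C  = P * F * (P * F)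

    instance
      C≢0 : NonZero C
      C≢0 = m*n≢0 (P * F) (P * F) {{m*n≢0 P F {{m^n≢0 p b′}} {{b′ !≢0}}}} {{m*n≢0 P F {{m^n≢0 p b′}} {{b′ !≢0}}}}

    [a/2]!≡ : (a / 2) ! ≡ P * F * U₂
    [a/2]!≡ = subst (λ x → (a / 2) ! ≡ p ^ x * x ! * U₂) (halves-commute a) [a/2]!-split

    p^a′≡ : p ^ a′ ≡ p ^ t * (P * (P * 1))
    p^a′≡ = begin
      p ^ a′              ≡⟨ cong (p ^_) (m≡m%n+[m/n]*n a′ 2) ⟩
      p ^ (t + b′ * 2)    ≡⟨ ^-distribˡ-+-* p t (b′ * 2) ⟩
      p ^ t * p ^ (b′ * 2) ≡⟨ cong (p ^ t *_) (^-*-assoc p b′ 2) ⟨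
      p ^ t * (P * (P * 1)) ∎

    r₁ : ∀ x P F u → (P * F * (P * F)) * (x * (u * u)) ≡ x * ((P * F * u) * (P * F * u))
    r₁ = solve-∀
    r₂ : ∀ T P F x u → T * (P * (P * 1)) * (x * (F * F)) * u ≡ (P * F * (P * F)) * (T * x * u)
    r₂ = solve-∀

    key : X * (U₂ * U₂) ≡ p ^ t * X′ * Uₐ
    key = *-cancelˡ-≡ _ _ C (begin
      C * (X * (U₂ * U₂))                          ≡⟨ r₁ X P F U₂ ⟩
      X * ((P * F * U₂) * (P * F * U₂))             ≡⟨ cong (λ y → X * (y * y)) [a/2]!≡ ⟨
      X * ((a / 2) ! * (a / 2) !)                   ≡⟨ a!≡ ⟨
      a !                                           ≡⟨ a!-split ⟩
      p ^ a′ * a′ ! * Uₐ                            ≡⟨ cong₂ (λ x y → x * y * Uₐ) p^a′≡ a′!≡ ⟩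
      p ^ t * (P * (P * 1)) * (X′ * (F * F)) * Uₐ   ≡⟨ r₂ (p ^ t) P F X′ Uₐ ⟩
      C * (p ^ t * X′ * Uₐ)                         ∎)

  central-primePower-step : ∀ a {X X′ U} e → ¬ p ∣ U → X ∣ p ^ (a / p % 2) * X′ * U → p ^ suc e ∣ X →
                       (∀ e → p ^ e ∣ X′ → e ≡ 0 ⊎ p ^ e ≤ a / p) → p ^ suc e ≤ a
  central-primePower-step a {X} {X′} e p∤U X∣ pᵉ∣X IH = begin
    p ^ suc e                ≡⟨ p^e≡ ⟩
    p ^ t * p ^ (suc e ∸ t)  ≤⟨ *-mono-≤ pᵗ≤p pᵉ⁻ᵗ≤a′ ⟩
    p * a′                   ≤⟨ subst (_≤ a) (*-comm a′ p) (m/n*n≤m a p) ⟩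
    a                        ∎
    where
    open ≤-Reasoning
    a′ t : ℕ
    a′ = a / p
    t  = a′ % 2

    t≤1 : t ≤ 1
    t≤1 = ≤-pred (m%n<n a′ 2)

    pᵗ≤p : p ^ t ≤ p
    pᵗ≤p = ≤-trans (^-monoʳ-≤ p t≤1) (≤-reflexive (*-identityʳ p))

    p^e≡ : p ^ suc e ≡ p ^ t * p ^ (suc e ∸ t)
    p^e≡ = trans (cong (p ^_) (sym (m+[n∸m]≡n (≤-trans t≤1 (s≤s z≤n))))) (^-distribˡ-+-* p t (suc e ∸ t))

    pᵉ⁻ᵗ∣X′ : p ^ (suc e ∸ t) ∣ X′
    pᵉ⁻ᵗ∣X′ = *-cancelˡ-∣ (p ^ t) {{m^n≢0 p t}}
                (subst (_∣ p ^ t * X′) p^e≡ (prime^∣-cancelʳ (suc e) p∤U (∣-trans pᵉ∣X X∣)))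

    pᵉ⁻ᵗ≤a′ : p ^ (suc e ∸ t) ≤ a′
    pᵉ⁻ᵗ≤a′ with IH (suc e ∸ t) pᵉ⁻ᵗ∣X′
    ... | inj₂ bound = bound
    ... | inj₁ e∸t≡0 = subst (λ x → p ^ x ≤ a′) (sym e∸t≡0) (n≢0⇒n>0 a′≢0)
      where
      a′≢0 : a′ ≢ 0
      a′≢0 a′≡0 = <⇒≱ (≤-trans (s≤s z≤n) (m∸n≡0⇒m≤n e∸t≡0)) (≤-reflexive (cong (_% 2) a′≡0))

  central-primePower : ∀ a {X} → a ! ≡ X * ((a / 2) ! * (a / 2) !) → ∀ e → p ^ e ∣ X → e ≡ 0 ⊎ p ^ e ≤ a
  central-primePower a = go (<-wellFounded a)
    where
    go : ∀ {a} → Acc _<_ a → ∀ {X} → a ! ≡ X * ((a / 2) ! * (a / 2) !) → ∀ e → p ^ e ∣ X → e ≡ 0 ⊎ p ^ e ≤ a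
    go _ _ zero _ = inj₁ refl
    go {zero} _ {X} 1≡X*1 (suc e) pᵉ∣X =
      contradiction (∣-trans (m∣m*n (p ^ e)) (subst (p ^ suc e ∣_) (trans (sym (*-identityʳ X)) (sym 1≡X*1)) pᵉ∣X)) (prime∤1 pp)
    go {a@(suc _)} (acc rec) a!≡ (suc e) pᵉ∣X =
      let X′ , U , a′!≡ , p∤U , X∣ = central-reduce a a!≡
      in  inj₂ (central-primePower-step a e p∤U X∣ pᵉ∣X (go (rec (m/n<m a p (prime≥2 pp))) a′!≡))

prime∣!⇒≤ : ∀ {p} → Prime p → ∀ n → p ∣ n ! → p ≤ n
prime∣!⇒≤ pp zero    p∣1 = contradiction p∣1 (prime∤1 pp)
prime∣!⇒≤ pp (suc n) p∣n! with euclidsLemma (suc n) (n !) pp p∣n!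
... | inj₁ p∣1+n = ∣⇒≤ p∣1+n
... | inj₂ p∣n!  = m≤n⇒m≤1+n (prime∣!⇒≤ pp n p∣n!)

2^i*i!*m!≤[i+m]! : ∀ {m} i → i ≤ m → 2 ^ i * i ! * m ! ≤ (i + m) !
2^i*i!*m!≤[i+m]! {m} zero    _   = ≤-reflexive (+-identityʳ (m !))
2^i*i!*m!≤[i+m]! {m} (suc i) i<m = begin
  2 ^ suc i * suc i ! * m !              ≡⟨ rearrange (2 ^ i) i (i !) (m !) ⟩
  (2 * suc i) * (2 ^ i * i ! * m !)      ≤⟨ *-mono-≤ 2+2i≤1+i+m (2^i*i!*m!≤[i+m]! i (<⇒≤ i<m)) ⟩
  suc (i + m) * (i + m) !                ∎
  where
  open ≤-Reasoning
  rearrange : ∀ t i f g → 2 * t * (f + i * f) * g ≡ 2 * suc i * (t * f * g)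
  rearrange = solve-∀
  2+2i≤1+i+m : 2 * suc i ≤ suc (i + m)
  2+2i≤1+i+m = subst (_≤ suc (i + m)) (sym (trans (cong (suc i +_) (+-identityʳ (suc i))) (cong suc (+-suc i i))))
                     (s≤s (subst (_≤ i + m) (+-suc i i) (+-monoʳ-≤ i i<m)))

central≥2^m : ∀ m {X} → (2 * m) ! ≡ X * (m ! * m !) → 2 ^ m ≤ X
central≥2^m m {X} [2m]!≡ = *-cancelʳ-≤ (2 ^ m) X (m ! * m !) {{m !* m !≢0}} (begin
  2 ^ m * (m ! * m !)   ≡⟨ *-assoc (2 ^ m) (m !) (m !) ⟨
  2 ^ m * m ! * m !     ≤⟨ 2^i*i!*m!≤[i+m]! m ≤-refl ⟩
  (m + m) !             ≡⟨ cong (λ x → (m + x) !) (+-identityʳ m) ⟨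
  (2 * m) !             ≡⟨ [2m]!≡ ⟩
  X * (m ! * m !)       ∎)
  where open ≤-Reasoning

chebyshev : ∀ m → 1 ≤ m → 2 ^ m ≤ (2 * m) ^ π (2 * m)
chebyshev m m≥1 with divides X [2m]!≡ ← [n/2]![n/2]!∣n! (2 * m) = begin
  2 ^ m                ≤⟨ 2^m≤X ⟩
  X                    ≤⟨ smooth-bound (2 * m) (≤-trans (m^n>0 2 m) 2^m≤X) prime-factors prime-powers ⟩
  (2 * m) ^ π (2 * m)  ∎
  where
  open ≤-Reasoning
  [2m]/2≡m : 2 * m / 2 ≡ m
  [2m]/2≡m = trans (cong (_/ 2) (*-comm 2 m)) (m*n/n≡m m 2)
  2^m≤X : 2 ^ m ≤ X
  2^m≤X = central≥2^m m (subst (λ h → (2 * m) ! ≡ X * (h ! * h !)) [2m]/2≡m [2m]!≡)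
  prime-factors : ∀ {q} → Prime q → q ∣ X → q ≤ 2 * m
  prime-factors pq q∣X = prime∣!⇒≤ pq (2 * m) (∣-trans q∣X (divides ((2 * m / 2) ! * (2 * m / 2) !) (trans [2m]!≡ (*-comm X _))))
  prime-powers : ∀ {q} e → Prime q → q ^ e ∣ X → q ^ e ≤ 2 * m
  prime-powers e pq qᵉ∣X with central-primePower pq (2 * m) [2m]!≡ e qᵉ∣X
  ... | inj₁ refl  = ≤-trans m≥1 (m≤m+n m (m + 0))
  ... | inj₂ bound = bound

8c+8≤2^c : ∀ c → 6 ≤ c → 8 * c + 8 ≤ 2 ^ c
8c+8≤2^c c 6≤c = subst (λ c → 8 * c + 8 ≤ 2 ^ c) (m+[n∸m]≡n 6≤c) (go (c ∸ 6))
  where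
  step : ∀ d → 8 * (6 + suc d) + 8 ≡ (8 * (6 + d) + 8) + 8
  step = solve-∀
  go : ∀ d → 8 * (6 + d) + 8 ≤ 2 ^ (6 + d)
  go zero    = ≤ᵇ⇒≤ 56 64 _
  go (suc d) = begin
    8 * (6 + suc d) + 8              ≡⟨ step d ⟩
    (8 * (6 + d) + 8) + 8            ≤⟨ +-mono-≤ (go d) (≤-trans (m≤n+m 8 (8 * (6 + d))) (go d)) ⟩
    2 ^ (6 + d) + 2 ^ (6 + d)        ≡⟨ cong (2 ^ (6 + d) +_) (+-identityʳ _) ⟨
    2 ^ (6 + suc d)                  ∎
    where open ≤-Reasoning

-- With c = ⌊k/8⌋ and m = 4ck: 2m ≤ k² < 2^(2c), so 2^m ≤ (2m)^π(2m) forces m ≤ 2c·π(2m).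
enoughPrimes-large : ∀ {k} → 48 ≤ k → ∃ λ M → M ≤ k * k × 2 * k ≤ π M
enoughPrimes-large {k} 48≤k = 2 * m , 2m≤k*k , 2k≤P
  where
  c m P : ℕ
  c = k / 8
  m = 2 * c * (2 * k)
  P = π (2 * m)

  6≤c : 6 ≤ c
  6≤c = /-monoˡ-≤ 8 48≤k

  2c≥1 : 1 ≤ 2 * c
  2c≥1 = ≤-trans (s≤s z≤n) (≤-trans 6≤c (m≤m+n c (c + 0)))

  8c≤k : c * 8 ≤ k
  8c≤k = m/n*n≤m k 8

  k<2^c : k < 2 ^ c
  k<2^c = begin-strict
    k                 ≡⟨ m≡m%n+[m/n]*n k 8 ⟩
    k % 8 + c * 8     <⟨ +-monoˡ-< (c * 8) (m%n<n k 8) ⟩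
    8 + c * 8         ≡⟨ +-comm 8 (c * 8) ⟩
    c * 8 + 8         ≡⟨ cong (_+ 8) (*-comm c 8) ⟩
    8 * c + 8         ≤⟨ 8c+8≤2^c c 6≤c ⟩
    2 ^ c             ∎
    where open ≤-Reasoning

  2m≤k*k : 2 * m ≤ k * k
  2m≤k*k = begin
    2 * m             ≡⟨ rearrange c k ⟩
    c * 8 * k         ≤⟨ *-monoˡ-≤ k 8c≤k ⟩
    k * k             ∎
    where
    open ≤-Reasoning
    rearrange : ∀ c k → 2 * (2 * c * (2 * k)) ≡ c * 8 * k
    rearrange = solve-∀

  m≤2cP : m ≤ 2 * c * P
  m≤2cP = ≮⇒≥ λ 2cP<m → <⇒≱ (^-monoʳ-< 2 (s≤s (s≤s z≤n)) 2cP<m) (begin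
    2 ^ m                    ≤⟨ chebyshev m m≥1 ⟩
    (2 * m) ^ P              ≤⟨ ^-monoˡ-≤ P (≤-trans 2m≤k*k (*-mono-≤ (<⇒≤ k<2^c) (<⇒≤ k<2^c))) ⟩
    (2 ^ c * 2 ^ c) ^ P      ≡⟨ cong (_^ P) (^-distribˡ-+-* 2 c c) ⟨
    (2 ^ (c + c)) ^ P        ≡⟨ cong (λ x → (2 ^ (c + x)) ^ P) (+-identityʳ c) ⟨
    (2 ^ (2 * c)) ^ P        ≡⟨ ^-*-assoc 2 (2 * c) P ⟩
    2 ^ (2 * c * P)          ∎)
    where
    open ≤-Reasoning
    m≥1 : 1 ≤ m
    m≥1 = *-mono-≤ 2c≥1 (≤-trans (s≤s z≤n) (≤-trans 48≤k (m≤m+n k (k + 0))))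

  2k≤P : 2 * k ≤ P
  2k≤P = *-cancelˡ-≤ (2 * c) {{>-nonZero 2c≥1}} m≤2cP

-- Prime vertex labels

lookup-injective : ∀ {A : Set} {xs : List A} → Unique xs → Injective _≡_ _≡_ (lookup xs)
lookup-injective {xs = _ ∷ _} (x∉ ∷ _) {zero}  {zero}  _  = refl
lookup-injective {xs = _ ∷ _} (x∉ ∷ _) {zero}  {suc j} eq = contradiction eq (All.lookup x∉ (∈-lookup j))
lookup-injective {xs = _ ∷ _} (x∉ ∷ _) {suc i} {zero}  eq = contradiction (sym eq) (All.lookup x∉ (∈-lookup i))
lookup-injective {xs = _ ∷ _} (_ ∷ u)  {suc i} {suc j} eq = cong suc (lookup-injective u eq)

primes-coprime : ∀ {p q} → Prime p → Prime q → p ≢ q → Coprime p q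
primes-coprime {p} {q} pp pq p≢q with <-cmp p q
... | tri< p<q _ _ = Coprime.sym (prime⇒coprime pq {{prime⇒nonZero pp}} p<q)
... | tri≈ _ p≡q _ = contradiction p≡q p≢q
... | tri> _ _ q<p = prime⇒coprime pp {{prime⇒nonZero pq}} q<p

smallPrimes : List ℕ
smallPrimes = 2 ∷ 3 ∷ 5 ∷ 7 ∷ 11 ∷ 13 ∷ 17 ∷ 19 ∷ 23 ∷ 29 ∷ 31 ∷ 37 ∷ 41 ∷ 43 ∷ 47 ∷ 53 ∷ 59 ∷ 61 ∷ 67 ∷ 71 ∷
              73 ∷ 79 ∷ 83 ∷ 89 ∷ 97 ∷ 101 ∷ 103 ∷ 107 ∷ 109 ∷ 113 ∷ 127 ∷ 131 ∷ 137 ∷ 139 ∷ 149 ∷ 151 ∷ 157 ∷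
              163 ∷ 167 ∷ 173 ∷ 179 ∷ 181 ∷ 191 ∷ 193 ∷ 197 ∷ 199 ∷ 211 ∷ 223 ∷ 227 ∷ 229 ∷ 233 ∷ 239 ∷ 241 ∷
              251 ∷ 257 ∷ 263 ∷ 269 ∷ 271 ∷ 277 ∷ 281 ∷ 283 ∷ 293 ∷ 307 ∷ 311 ∷ 313 ∷ 317 ∷ 331 ∷ 337 ∷ 347 ∷
              349 ∷ 353 ∷ 359 ∷ 367 ∷ 373 ∷ 379 ∷ 383 ∷ 389 ∷ 397 ∷ 401 ∷ 409 ∷ 419 ∷ 421 ∷ 431 ∷ 433 ∷ 439 ∷
              443 ∷ 449 ∷ 457 ∷ 461 ∷ 463 ∷ 467 ∷ 479 ∷ 487 ∷ 491 ∷ []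

smallPrimes-prime : All Prime smallPrimes
smallPrimes-prime = toWitness {a? = all? prime? smallPrimes} _

smallPrimes-unique : Unique smallPrimes
smallPrimes-unique = toWitness {a? = unique? smallPrimes} _

record PrimeSupply (k : ℕ) : Set where
  field
    primes   : List ℕ
    allPrime : All Prime primes
    unique   : Unique primes
    enough   : 2 * k ≤ length primes
    small    : All (_< k * suc k) primes

FirstPrimesSuffice : ℕ → Set
FirstPrimesSuffice k = 2 * k ≤ length (take (2 * k) smallPrimes) × All (_< k * suc k) (take (2 * k) smallPrimes)

smallPrimes-suffice : ∀ {k} → k < 48 → 4 ≤ k → FirstPrimesSuffice k
smallPrimes-suffice = toWitness {a? = allUpTo? (λ k → (4 ≤? k) →-dec suffice? k) 48} _
  where
  suffice? : ∀ k → Dec (FirstPrimesSuffice k)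
  suffice? k = (2 * k ≤? length (take (2 * k) smallPrimes)) ×-dec all? (_<? k * suc k) (take (2 * k) smallPrimes)

smallPrimeSupply : ∀ {k} → k < 48 → 4 ≤ k → PrimeSupply k
smallPrimeSupply {k} k<48 4≤k = record
  { primes   = take (2 * k) smallPrimes
  ; allPrime = Allₚ.take⁺ (2 * k) smallPrimes-prime
  ; unique   = Uniqueₚ.take⁺ (2 * k) smallPrimes-unique
  ; enough   = proj₁ (smallPrimes-suffice k<48 4≤k)
  ; small    = proj₂ (smallPrimes-suffice k<48 4≤k)
  }

largePrimeSupply : ∀ {k} → 48 ≤ k → PrimeSupply k
largePrimeSupply {k} 48≤k = supply (enoughPrimes-large 48≤k)
  where
  supply : (∃ λ M → M ≤ k * k × 2 * k ≤ π M) → PrimeSupply k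
  supply (M , M≤k*k , 2k≤πM) = record
    { primes   = primesUpTo M
    ; allPrime = primesUpTo-prime M
    ; unique   = primesUpTo-unique M
    ; enough   = 2k≤πM
    ; small    = All.map below (primesUpTo-≤ M)
    }
    where
    below : ∀ {p} → p ≤ M → p < k * suc k
    below p≤M = ≤-<-trans (≤-trans p≤M M≤k*k) (*-monoʳ-< k {{ℕ.>-nonZero (≤-trans (s≤s z≤n) 48≤k)}} (n<1+n k))

primeSupply : ∀ {k} → 4 ≤ k → PrimeSupply k
primeSupply {k} 4≤k with k <? 48
... | yes k<48 = smallPrimeSupply k<48 4≤k
... | no  k≮48 = largePrimeSupply (≮⇒≥ k≮48)

module UnitAndPrimes {n} (p : Fin n → ℕ) (p-inj : Injective _≡_ _≡_ p) (p-prime : ∀ i → Prime (p i)) where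

  label : Fin (suc n) → ℕ
  label zero    = 1
  label (suc i) = p i

  label-injective : Injective _≡_ _≡_ label
  label-injective {zero}  {zero}  _  = refl
  label-injective {zero}  {suc j} eq = contradiction (sym eq) (>⇒≢ (prime≥2 (p-prime j)))
  label-injective {suc i} {zero}  eq = contradiction eq (>⇒≢ (prime≥2 (p-prime i)))
  label-injective {suc i} {suc j} eq = cong suc (p-inj eq)

  label-positive : ∀ v → 1 ≤ label v
  label-positive zero    = ≤-refl
  label-positive (suc i) = ≤-trans (s≤s z≤n) (prime≥2 (p-prime i))

  label-coprime : ∀ u v → u ≢ v → Coprime (label u) (label v)
  label-coprime zero    v       _   = 1-coprimeTo (label v)
  label-coprime (suc i) zero    _   = Coprime.sym (1-coprimeTo (p i))
  label-coprime (suc i) (suc j) i≢j = primes-coprime (p-prime i) (p-prime j) (i≢j ∘ cong suc ∘ p-inj)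

totalPrime-fromSupply : ∀ {k} → 2 ≤ k → PrimeSupply k → TotalPrime (windmill (suc k) 2)
totalPrime-fromSupply {k} 2≤k supply =
  totalPrime-fromLabels label label-injective label-positive label< λ u v uv → label-coprime u v λ { refl → Graph.irrefl G uv }
  where
  open Windmill k
  open Chain 2≤k
  open PrimeSupply supply

  p : Fin (2 * k) → ℕ
  p i = lookup primes (inject≤ i enough)

  p-inj : Injective _≡_ _≡_ p
  p-inj eq = Finₚ.inject≤-injective enough enough _ _ (lookup-injective unique eq)

  open UnitAndPrimes p p-inj (λ i → All.lookup allPrime (∈-lookup _))

  label< : ∀ v → label v < k * suc k
  label< zero    = *-mono-≤ (≤-trans (s≤s z≤n) 2≤k) (s≤s (≤-trans (s≤s z≤n) 2≤k))
  label< (suc i) = All.lookup small (∈-lookup _)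

-- Only five primes lie below 12, so one copy needs the composite label 6.
windmill₄-totalPrime : TotalPrime (windmill 4 2)
windmill₄-totalPrime = totalPrime-fromLabels label
  (λ {u} {v} → toWitness {a? = Finₚ.all? λ u → Finₚ.all? λ v → (label u ≟ label v) →-dec (u Finₚ.≟ v)} _ u v)
  (toWitness {a? = Finₚ.all? λ v → 1 ≤? label v} _)
  (toWitness {a? = Finₚ.all? λ v → label v <? 12} _)
  (toWitness {a? = Finₚ.all? λ u → Finₚ.all? λ v → Graph.adj? G u v →-dec coprime? (label u) (label v)} _)
  where
  open Windmill 3
  open Chain (s≤s (s≤s z≤n))
  label : Fin 7 → ℕ
  label = Vec.lookup (1 Vec.∷ 2 Vec.∷ 3 Vec.∷ 11 Vec.∷ 5 Vec.∷ 6 Vec.∷ 7 Vec.∷ Vec.[])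

mainTheorem7 : (n : ℕ) → 4 ≤ n → TotalPrime (windmill n 2)
mainTheorem7 (suc (suc (suc (suc zero))))    (s≤s (s≤s (s≤s (s≤s _)))) = windmill₄-totalPrime
mainTheorem7 (suc (suc (suc (suc (suc j))))) (s≤s (s≤s (s≤s (s≤s _)))) =
  totalPrime-fromSupply (s≤s (s≤s z≤n)) (primeSupply (s≤s (s≤s (s≤s (s≤s z≤n)))))
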